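{- Let $\gamma_0=\frac{\sqrt5-1}{2}$. There exist absolute constants $c_0>0$ and $C>0$ such that the following holds: for every integer $r\geq 3$, every positive integer $N$ and every real $k>0$ with $k<c_0N^{\gamma_0-C/r}$, we have $$\max_{1\leq m\leq 3Nk}\tau(m;2N,2N+2k)\leq r-1,$$ where the maximum is over positive integers $m\leq 3Nk$.
   Context: For a positive integer $m$ and reals $a\leq b$, $\tau(m;a,b)=\#\{d\in\mathbb{N}: d\mid m,\ a\leq d\leq b\}$ denotes the number of divisors of $m$ in the interval $[a,b]$.
   Formalization: The parameter k ranges over the positive rationals instead of the positive reals, and the constants $c_0$ and $C$ are taken in ℚ. -}

module Defs where

open import Data.Nat as ℕ using (ℕ; zero; suc)
open import Data.Nat.Divisibility using (_∣?_)
open import Data.Integer as ℤ using (+_)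
open import Data.Rational using (ℚ; 0ℚ; 1ℚ; _/_; _+_; _*_; _<_; _≤_; _≤?_)
open import Data.List using (List; length; filter; map; upTo)
open import Data.Product using (_×_; ∃-syntax)
open import Data.Sum using (_⊎_)
open import Relation.Nullary.Decidable using (_×-dec_)

ℕ→ℚ : ℕ → ℚ
ℕ→ℚ n = + n / 1

pow : ℚ → ℕ → ℚ
pow x zero = 1ℚ
pow x (suc n) = x * pow x n

-- 1/r for r ≥ 1 (value at r = 0 is irrelevant; only used with r ≥ 3)
recip : ℕ → ℚ
recip zero = 0ℚ
recip (suc r) = + 1 / suc r

-- τ(m; a, b) = #{ d ∈ ℕ : d ∣ m, a ≤ d ≤ b }, for m ≥ 1 (divisors of m lie in 1..m)
τ : ℕ → ℚ → ℚ → ℕ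
τ m a b = length (filter (λ d → (d ∣? m) ×-dec ((a ≤? ℕ→ℚ d) ×-dec (ℕ→ℚ d ≤? b)))
                         (map suc (upTo m)))

-- t < γ₀ = (√5 - 1)/2, for rational t.  γ₀ is the positive root of t² + t = 1,
-- so t < γ₀  ⇔  t < 0  or  t² + t < 1.
LtGamma0 : ℚ → Set
LtGamma0 t = t < 0ℚ ⊎ (t * t + t) < 1ℚ

-- BelowBound c₀ C r N k  encodes the real inequality  k < c₀ · N^(γ₀ - C/r)
-- (for c₀, k > 0 and N ≥ 1): there is a rational exponent s = (b - a)/q
-- with s < γ₀ - C/r and  k < c₀ · N^s,  the latter written without roots
-- as  k^q · N^a < c₀^q · N^b.
BelowBound : ℚ → ℚ → ℕ → ℕ → ℚ → Set
BelowBound c₀ C r N k =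
  ∃[ a ] ∃[ b ] ∃[ q ]
    ( LtGamma0 (((+ b ℤ.- + a) / suc q) + C * recip r)
    × (pow k (suc q) * pow (ℕ→ℚ N) a) < (pow c₀ (suc q) * pow (ℕ→ℚ N) b) )

{-# OPTIONS --safe #-}
-- Suppose m has r distinct divisors x₁, …, x_r in [2N, 2N + 2k]. Comparing p-adic valuations prime by
-- prime gives ∏ xᵢ^α ∣ m^A · ∏_{i<j} gcd(xᵢ, xⱼ) with A = (α + 1) C 2, and gcd(xᵢ, xⱼ) divides
-- |xᵢ − xⱼ| ≤ 2k. Hence (2N)^(rα) ≤ m^A (2k)^(r C 2), and with K = 6k ≥ m/N this gives N^(rα − A) ≤ K^Y
-- for Y = A + r C 2. Choosing α maximal with α² + αr ≤ r², i.e. α ≤ γ₀r < α + 1, makes the exponent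
-- ratio (rα − A)/Y at least (α − 1)/r > γ₀ − 2/r. For c₀ = 1/6 the hypothesis k < c₀ N^s with
-- s < γ₀ − 2/r reads K < N^s, which contradicts N^(rα − A) ≤ K^Y.

module Submission where

open import Defs

module RationalOrder where

  open import Data.Rational as ℚ using (0ℚ; _+_; _*_; _≤_; _<_)
  import Data.Rational.Properties as ℚP
  open import Relation.Binary.PropositionalEquality using (refl)
  open import Relation.Nullary using (¬_; yes; no; contradiction)

  <⇒≱ : ∀ {x y} → x < y → ¬ y ≤ x
  <⇒≱ x<y y≤x = ℚP.<-irrefl refl (ℚP.<-≤-trans x<y y≤x)

  +-cancelʳ-< : ∀ {x y z} → x + z < y + z → x < y
  +-cancelʳ-< {x} {y} {z} x+z<y+z with x ℚ.<? y
  ... | yes x<y = x<y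
  ... | no x≮y  = contradiction (ℚP.+-monoˡ-≤ z (ℚP.≮⇒≥ x≮y)) (<⇒≱ x+z<y+z)

  +-≤-+-cancelˡ : ∀ {a u v w} → u + v ≤ a + w → a ≤ u → v ≤ w
  +-≤-+-cancelˡ {a} {u} {v} {w} u+v≤a+w a≤u with v ℚ.≤? w
  ... | yes v≤w = v≤w
  ... | no v≰w  = contradiction u+v≤a+w (<⇒≱ (ℚP.+-mono-≤-< a≤u (ℚP.≰⇒> v≰w)))

  *-nonNeg : ∀ {x y} → 0ℚ ≤ x → 0ℚ ≤ y → 0ℚ ≤ x * y
  *-nonNeg {x} {y} 0≤x 0≤y =
    ℚP.nonNegative⁻¹ _ {{ℚP.nonNeg*nonNeg⇒nonNeg x {{ℚ.nonNegative 0≤x}} y {{ℚ.nonNegative 0≤y}}}}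

  *-pos : ∀ {x y} → 0ℚ < x → 0ℚ < y → 0ℚ < x * y
  *-pos {x} {y} 0<x 0<y = ℚP.positive⁻¹ _ {{ℚP.pos*pos⇒pos x {{ℚ.positive 0<x}} y {{ℚ.positive 0<y}}}}

  *-mono-≤-nonNeg : ∀ {x y u v} → 0ℚ ≤ x → 0ℚ ≤ u → x ≤ y → u ≤ v → x * u ≤ y * v
  *-mono-≤-nonNeg {x} {y} {u} {v} 0≤x 0≤u x≤y u≤v = begin
    x * u  ≤⟨ ℚP.*-monoʳ-≤-nonNeg u {{ℚ.nonNegative 0≤u}} x≤y ⟩
    y * u  ≤⟨ ℚP.*-monoˡ-≤-nonNeg y {{ℚ.nonNegative (ℚP.≤-trans 0≤x x≤y)}} u≤v ⟩
    y * v  ∎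
    where open ℚP.≤-Reasoning

module ℕ→ℚ-Properties where

  open import Data.Nat as ℕ using (suc; NonZero)
  import Data.Nat.Properties as ℕP
  open import Data.Integer as ℤ using (+_)
  import Data.Integer.Properties as ℤP
  open import Data.Rational as ℚ using (0ℚ; 1ℚ; _+_; _*_; _/_; _≤_; _<_; toℚᵘ)
  import Data.Rational.Properties as ℚP
  open import Data.Rational.Unnormalised as ℚᵘ using (mkℚᵘ; *≡*)
  import Data.Rational.Unnormalised.Properties as ℚᵘP
  open import Data.Integer.Tactic.RingSolver using (solve-∀)
  open import Relation.Binary.PropositionalEquality
  open import Relation.Nullary using (yes; no; contradiction)
  open RationalOrder

  private
    toℚᵘ-ℕ→ℚ : ∀ n → toℚᵘ (ℕ→ℚ n) ℚᵘ.≃ mkℚᵘ (+ n) 0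
    toℚᵘ-ℕ→ℚ n = ℚP.toℚᵘ-fromℚᵘ (mkℚᵘ (+ n) 0)

    toℚᵘ-/ : ∀ i n → toℚᵘ (i / suc n) ℚᵘ.≃ mkℚᵘ i n
    toℚᵘ-/ i n = ℚP.toℚᵘ-fromℚᵘ (mkℚᵘ i n)

  ℕ→ℚ-homo-+ : ∀ m n → ℕ→ℚ (m ℕ.+ n) ≡ ℕ→ℚ m + ℕ→ℚ n
  ℕ→ℚ-homo-+ m n = ℚP.toℚᵘ-injective (begin
    toℚᵘ (ℕ→ℚ (m ℕ.+ n))            ≈⟨ toℚᵘ-ℕ→ℚ (m ℕ.+ n) ⟩
    mkℚᵘ (+ (m ℕ.+ n)) 0             ≈⟨ *≡* (cong (ℤ._* + 1) +-pos) ⟩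
    mkℚᵘ (+ m) 0 ℚᵘ.+ mkℚᵘ (+ n) 0   ≈⟨ ℚᵘP.+-cong (toℚᵘ-ℕ→ℚ m) (toℚᵘ-ℕ→ℚ n) ⟨
    toℚᵘ (ℕ→ℚ m) ℚᵘ.+ toℚᵘ (ℕ→ℚ n)  ≈⟨ ℚP.toℚᵘ-homo-+ (ℕ→ℚ m) (ℕ→ℚ n) ⟨
    toℚᵘ (ℕ→ℚ m + ℕ→ℚ n)            ∎)
    where
    open ℚᵘP.≃-Reasoning
    +-pos : + (m ℕ.+ n) ≡ + m ℤ.* + 1 ℤ.+ + n ℤ.* + 1
    +-pos = trans (ℤP.pos-+ m n) (sym (cong₂ ℤ._+_ (ℤP.*-identityʳ (+ m)) (ℤP.*-identityʳ (+ n))))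

  ℕ→ℚ-homo-* : ∀ m n → ℕ→ℚ (m ℕ.* n) ≡ ℕ→ℚ m * ℕ→ℚ n
  ℕ→ℚ-homo-* m n = ℚP.toℚᵘ-injective (begin
    toℚᵘ (ℕ→ℚ (m ℕ.* n))            ≈⟨ toℚᵘ-ℕ→ℚ (m ℕ.* n) ⟩
    mkℚᵘ (+ (m ℕ.* n)) 0             ≈⟨ *≡* (cong (ℤ._* + 1) (ℤP.pos-* m n)) ⟩
    mkℚᵘ (+ m) 0 ℚᵘ.* mkℚᵘ (+ n) 0   ≈⟨ ℚᵘP.*-cong (toℚᵘ-ℕ→ℚ m) (toℚᵘ-ℕ→ℚ n) ⟨
    toℚᵘ (ℕ→ℚ m) ℚᵘ.* toℚᵘ (ℕ→ℚ n)  ≈⟨ ℚP.toℚᵘ-homo-* (ℕ→ℚ m) (ℕ→ℚ n) ⟨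
    toℚᵘ (ℕ→ℚ m * ℕ→ℚ n)            ∎)
    where open ℚᵘP.≃-Reasoning

  ℕ→ℚ-nonNeg : ∀ n → 0ℚ ≤ ℕ→ℚ n
  ℕ→ℚ-nonNeg n = ℚP.nonNegative⁻¹ _ {{ℚP.normalize-nonNeg n 1}}

  ℕ→ℚ-pos : ∀ n → .{{NonZero n}} → 0ℚ < ℕ→ℚ n
  ℕ→ℚ-pos n = ℚP.positive⁻¹ _ {{ℚP.normalize-pos n 1}}

  ℕ→ℚ-+-∸ : ∀ {m n} → m ℕ.≤ n → ℕ→ℚ n ≡ ℕ→ℚ m + ℕ→ℚ (n ℕ.∸ m)
  ℕ→ℚ-+-∸ {m} {n} m≤n = trans (cong ℕ→ℚ (sym (ℕP.m+[n∸m]≡n m≤n))) (ℕ→ℚ-homo-+ m (n ℕ.∸ m))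

  ℕ→ℚ-mono-≤ : ∀ {m n} → m ℕ.≤ n → ℕ→ℚ m ≤ ℕ→ℚ n
  ℕ→ℚ-mono-≤ {m} {n} m≤n = begin
    ℕ→ℚ m                       ≡⟨ ℚP.+-identityʳ (ℕ→ℚ m) ⟨
    ℕ→ℚ m + 0ℚ                  ≤⟨ ℚP.+-monoʳ-≤ (ℕ→ℚ m) (ℕ→ℚ-nonNeg (n ℕ.∸ m)) ⟩
    ℕ→ℚ m + ℕ→ℚ (n ℕ.∸ m)       ≡⟨ ℕ→ℚ-+-∸ m≤n ⟨
    ℕ→ℚ n                       ∎
    where open ℚP.≤-Reasoning

  ℕ→ℚ-mono-< : ∀ {m n} → m ℕ.< n → ℕ→ℚ m < ℕ→ℚ n
  ℕ→ℚ-mono-< {m} {n} m<n = begin-strict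
    ℕ→ℚ m                       ≡⟨ ℚP.+-identityʳ (ℕ→ℚ m) ⟨
    ℕ→ℚ m + 0ℚ                  <⟨ ℚP.+-monoʳ-< (ℕ→ℚ m) (ℕ→ℚ-pos (n ℕ.∸ m) {{n∸m≢0}}) ⟩
    ℕ→ℚ m + ℕ→ℚ (n ℕ.∸ m)       ≡⟨ ℕ→ℚ-+-∸ (ℕP.<⇒≤ m<n) ⟨
    ℕ→ℚ n                       ∎
    where
    open ℚP.≤-Reasoning
    n∸m≢0 : NonZero (n ℕ.∸ m)
    n∸m≢0 = ℕ.>-nonZero (ℕP.m<n⇒0<n∸m m<n)

  ℕ→ℚ-cancel-< : ∀ {m n} → ℕ→ℚ m < ℕ→ℚ n → m ℕ.< n
  ℕ→ℚ-cancel-< {m} {n} m<n with m ℕ.<? n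
  ... | yes m<n′ = m<n′
  ... | no m≮n = contradiction (ℕ→ℚ-mono-≤ (ℕP.≮⇒≥ m≮n)) (<⇒≱ m<n)

  recip-inverseˡ : ∀ r → .{{NonZero r}} → recip r * ℕ→ℚ r ≡ 1ℚ
  recip-inverseˡ (suc r) = ℚP.toℚᵘ-injective (begin
    toℚᵘ (recip (suc r) * ℕ→ℚ (suc r))
      ≈⟨ ℚP.toℚᵘ-homo-* (recip (suc r)) (ℕ→ℚ (suc r)) ⟩
    toℚᵘ (recip (suc r)) ℚᵘ.* toℚᵘ (ℕ→ℚ (suc r))
      ≈⟨ ℚᵘP.*-cong (toℚᵘ-/ (+ 1) r) (toℚᵘ-ℕ→ℚ (suc r)) ⟩
    mkℚᵘ (+ 1) r ℚᵘ.* mkℚᵘ (+ suc r) 0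
      ≈⟨ *≡* eq ⟩
    toℚᵘ 1ℚ
      ∎)
    where
    open ℚᵘP.≃-Reasoning
    eq : (+ 1 ℤ.* + suc r) ℤ.* + 1 ≡ + 1 ℤ.* + (suc r ℕ.* 1)
    eq = trans (ℤP.*-identityʳ _) (cong (λ n → + 1 ℤ.* + n) (sym (ℕP.*-identityʳ (suc r))))

  [b-a]/q*q+a≡b : ∀ a b q → (+ b ℤ.- + a) / suc q * ℕ→ℚ (suc q) + ℕ→ℚ a ≡ ℕ→ℚ b
  [b-a]/q*q+a≡b a b q = ℚP.toℚᵘ-injective (begin
    toℚᵘ (s * ℕ→ℚ (suc q) + ℕ→ℚ a)
      ≈⟨ ℚP.toℚᵘ-homo-+ (s * ℕ→ℚ (suc q)) (ℕ→ℚ a) ⟩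
    toℚᵘ (s * ℕ→ℚ (suc q)) ℚᵘ.+ toℚᵘ (ℕ→ℚ a)
      ≈⟨ ℚᵘP.+-cong (ℚP.toℚᵘ-homo-* s (ℕ→ℚ (suc q))) (toℚᵘ-ℕ→ℚ a) ⟩
    toℚᵘ s ℚᵘ.* toℚᵘ (ℕ→ℚ (suc q)) ℚᵘ.+ mkℚᵘ (+ a) 0
      ≈⟨ ℚᵘP.+-congˡ (mkℚᵘ (+ a) 0) (ℚᵘP.*-cong (toℚᵘ-/ (+ b ℤ.- + a) q) (toℚᵘ-ℕ→ℚ (suc q))) ⟩
    mkℚᵘ (+ b ℤ.- + a) q ℚᵘ.* mkℚᵘ (+ suc q) 0 ℚᵘ.+ mkℚᵘ (+ a) 0
      ≈⟨ *≡* eq ⟩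
    mkℚᵘ (+ b) 0
      ≈⟨ toℚᵘ-ℕ→ℚ b ⟨
    toℚᵘ (ℕ→ℚ b)
      ∎)
    where
    open ℚᵘP.≃-Reasoning
    s = (+ b ℤ.- + a) / suc q
    cancel : ∀ B A Q → ((B ℤ.- A) ℤ.* Q ℤ.* + 1 ℤ.+ A ℤ.* Q) ℤ.* + 1 ≡ B ℤ.* Q
    cancel = solve-∀
    eq : ((+ b ℤ.- + a) ℤ.* + suc q ℤ.* + 1 ℤ.+ + a ℤ.* + (suc q ℕ.* 1)) ℤ.* + 1 ≡ + b ℤ.* + (suc q ℕ.* 1 ℕ.* 1)
    eq = trans (cong (λ n → ((+ b ℤ.- + a) ℤ.* + suc q ℤ.* + 1 ℤ.+ + a ℤ.* + n) ℤ.* + 1) (ℕP.*-identityʳ (suc q)))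
           (trans (cancel (+ b) (+ a) (+ suc q))
             (cong (λ n → + b ℤ.* + n) (sym (trans (ℕP.*-identityʳ (suc q ℕ.* 1)) (ℕP.*-identityʳ (suc q))))))

module RationalPower where

  open import Data.Nat as ℕ using (zero; suc; NonZero)
  import Data.Nat.Properties as ℕP
  open import Data.Rational as ℚ using (0ℚ; 1ℚ; _+_; _*_; _≤_; _<_)
  import Data.Rational.Properties as ℚP
  open import Algebra.Bundles using (CommutativeRing)
  open import Relation.Binary.PropositionalEquality
  open import Relation.Nullary using (yes; no; contradiction)
  open RationalOrder
  open ℕ→ℚ-Properties

  open import Algebra.Properties.CommutativeSemiring.Exp
    (CommutativeRing.commutativeSemiring ℚP.+-*-commutativeRing) public
    using (_^_; ^-homo-*; ^-assocʳ; ^-distrib-*)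

  pow≡^ : ∀ x n → pow x n ≡ x ^ n
  pow≡^ x zero    = refl
  pow≡^ x (suc n) = cong (x *_) (pow≡^ x n)

  ^-zeroˡ : ∀ n → 1ℚ ^ n ≡ 1ℚ
  ^-zeroˡ zero    = refl
  ^-zeroˡ (suc n) = trans (ℚP.*-identityˡ (1ℚ ^ n)) (^-zeroˡ n)

  ℕ→ℚ-homo-^ : ∀ m n → ℕ→ℚ (m ℕ.^ n) ≡ ℕ→ℚ m ^ n
  ℕ→ℚ-homo-^ m zero    = refl
  ℕ→ℚ-homo-^ m (suc n) = trans (ℕ→ℚ-homo-* m (m ℕ.^ n)) (cong (ℕ→ℚ m *_) (ℕ→ℚ-homo-^ m n))

  ^-nonNeg : ∀ {x} n → 0ℚ ≤ x → 0ℚ ≤ x ^ n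
  ^-nonNeg zero    0≤x = ℚP.nonNegative⁻¹ 1ℚ
  ^-nonNeg (suc n) 0≤x = *-nonNeg 0≤x (^-nonNeg n 0≤x)

  ^-pos : ∀ {x} n → 0ℚ < x → 0ℚ < x ^ n
  ^-pos zero    0<x = ℚP.positive⁻¹ 1ℚ
  ^-pos (suc n) 0<x = *-pos 0<x (^-pos n 0<x)

  ^-monoˡ-≤ : ∀ {x y} n → 0ℚ ≤ x → x ≤ y → x ^ n ≤ y ^ n
  ^-monoˡ-≤ zero    0≤x x≤y = ℚP.≤-refl
  ^-monoˡ-≤ (suc n) 0≤x x≤y = *-mono-≤-nonNeg 0≤x (^-nonNeg n 0≤x) x≤y (^-monoˡ-≤ n 0≤x x≤y)

  ^-monoˡ-< : ∀ {x y} n → .{{NonZero n}} → 0ℚ ≤ x → x < y → x ^ n < y ^ n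
  ^-monoˡ-< {x} {y} (suc n) 0≤x x<y = begin-strict
    x * x ^ n  ≤⟨ ℚP.*-monoˡ-≤-nonNeg x {{ℚ.nonNegative 0≤x}} (^-monoˡ-≤ n 0≤x (ℚP.<⇒≤ x<y)) ⟩
    x * y ^ n  <⟨ ℚP.*-monoˡ-<-pos (y ^ n) {{ℚ.positive (^-pos n (ℚP.≤-<-trans 0≤x x<y))}} x<y ⟩
    y * y ^ n  ∎
    where open ℚP.≤-Reasoning

  1≤^ : ∀ {x} n → 1ℚ ≤ x → 1ℚ ≤ x ^ n
  1≤^ zero    1≤x = ℚP.≤-refl
  1≤^ (suc n) 1≤x = *-mono-≤-nonNeg (ℚP.nonNegative⁻¹ 1ℚ) (ℚP.nonNegative⁻¹ 1ℚ) 1≤x (1≤^ n 1≤x)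

  ^-monoʳ-≤ : ∀ {x m n} → 1ℚ ≤ x → m ℕ.≤ n → x ^ m ≤ x ^ n
  ^-monoʳ-≤ {x} {m} {n} 1≤x m≤n = begin
    x ^ m                    ≡⟨ ℚP.*-identityʳ (x ^ m) ⟨
    x ^ m * 1ℚ               ≤⟨ ℚP.*-monoˡ-≤-nonNeg (x ^ m) {{ℚ.nonNegative 0≤x^m}} (1≤^ (n ℕ.∸ m) 1≤x) ⟩
    x ^ m * x ^ (n ℕ.∸ m)    ≡⟨ ^-homo-* x m (n ℕ.∸ m) ⟨
    x ^ (m ℕ.+ (n ℕ.∸ m))    ≡⟨ cong (x ^_) (ℕP.m+[n∸m]≡n m≤n) ⟩
    x ^ n                    ∎
    where
    open ℚP.≤-Reasoning
    0≤x^m = ^-nonNeg m (ℚP.≤-trans (ℚP.nonNegative⁻¹ 1ℚ) 1≤x)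

  ^-cancelʳ-< : ∀ {x m n} → 1ℚ ≤ x → x ^ m < x ^ n → m ℕ.< n
  ^-cancelʳ-< {m = m} {n} 1≤x x^m<x^n with m ℕ.<? n
  ... | yes m<n = m<n
  ... | no m≮n  = contradiction (^-monoʳ-≤ 1≤x (ℕP.≮⇒≥ m≮n)) (<⇒≱ x^m<x^n)

  ^-^-comm : ∀ x m n → (x ^ m) ^ n ≡ (x ^ n) ^ m
  ^-^-comm x m n = begin
    (x ^ m) ^ n    ≡⟨ ^-assocʳ x m n ⟩
    x ^ (m ℕ.* n)  ≡⟨ cong (x ^_) (ℕP.*-comm m n) ⟩
    x ^ (n ℕ.* m)  ≡⟨ ^-assocʳ x n m ⟨
    (x ^ n) ^ m    ∎
    where open ≡-Reasoning

  ^-+-* : ∀ x u q a e → x ^ (u ℕ.* q ℕ.+ a ℕ.* e) ≡ (x ^ u) ^ q * (x ^ a) ^ e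
  ^-+-* x u q a e = trans (^-homo-* x (u ℕ.* q) (a ℕ.* e)) (sym (cong₂ _*_ (^-assocʳ x u q) (^-assocʳ x a e)))

  -- Raise the first bound to the q-th power and the second to the e-th power; the powers of y then cancel.
  ^-bounds⇒exponent-< : ∀ {x y} u v a b q e → .{{NonZero e}} → 1ℚ ≤ x → 0ℚ ≤ y →
                        x ^ u ≤ x ^ v * y ^ e → y ^ q * x ^ a < x ^ b →
                        u ℕ.* q ℕ.+ a ℕ.* e ℕ.< v ℕ.* q ℕ.+ b ℕ.* e
  ^-bounds⇒exponent-< {x} {y} u v a b q e 1≤x 0≤y x^u≤ <x^b = ^-cancelʳ-< 1≤x (begin-strict
    x ^ (u ℕ.* q ℕ.+ a ℕ.* e)              ≡⟨ ^-+-* x u q a e ⟩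
    (x ^ u) ^ q * (x ^ a) ^ e               ≤⟨ ℚP.*-monoʳ-≤-nonNeg ((x ^ a) ^ e)
                                                {{ℚ.nonNegative (^-nonNeg e (^-nonNeg a 0≤x))}}
                                                (^-monoˡ-≤ q (^-nonNeg u 0≤x) x^u≤) ⟩
    (x ^ v * y ^ e) ^ q * (x ^ a) ^ e       ≡⟨ regroup ⟩
    (x ^ v) ^ q * (y ^ q * x ^ a) ^ e       <⟨ ℚP.*-monoʳ-<-pos ((x ^ v) ^ q) {{ℚ.positive (^-pos q (^-pos v 0<x))}}
                                                (^-monoˡ-< e (*-nonNeg (^-nonNeg q 0≤y) (^-nonNeg a 0≤x)) <x^b) ⟩
    (x ^ v) ^ q * (x ^ b) ^ e               ≡⟨ ^-+-* x v q b e ⟨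
    x ^ (v ℕ.* q ℕ.+ b ℕ.* e)              ∎)
    where
    open ℚP.≤-Reasoning
    0<x = ℚP.<-≤-trans (ℚP.positive⁻¹ 1ℚ) 1≤x
    0≤x = ℚP.<⇒≤ 0<x
    regroup : (x ^ v * y ^ e) ^ q * (x ^ a) ^ e ≡ (x ^ v) ^ q * (y ^ q * x ^ a) ^ e
    regroup = begin-equality
      (x ^ v * y ^ e) ^ q * (x ^ a) ^ e        ≡⟨ cong (_* (x ^ a) ^ e) (^-distrib-* (x ^ v) (y ^ e) q) ⟩
      (x ^ v) ^ q * (y ^ e) ^ q * (x ^ a) ^ e  ≡⟨ ℚP.*-assoc ((x ^ v) ^ q) _ _ ⟩
      (x ^ v) ^ q * ((y ^ e) ^ q * (x ^ a) ^ e) ≡⟨ cong (λ z → (x ^ v) ^ q * (z * (x ^ a) ^ e)) (^-^-comm y e q) ⟩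
      (x ^ v) ^ q * ((y ^ q) ^ e * (x ^ a) ^ e) ≡⟨ cong ((x ^ v) ^ q *_) (^-distrib-* (y ^ q) (x ^ a) e) ⟨
      (x ^ v) ^ q * (y ^ q * x ^ a) ^ e        ∎

module PairwiseGcd where

  open import Data.Nat
  open import Data.Nat.Properties
  open import Data.Nat.Divisibility
  open import Data.Nat.GCD
  open import Data.Nat.Coprimality using (Coprime; coprime-divisor)
  open import Data.Nat.Primality using (Prime; prime⇒irreducible; prime⇒nonZero)
  open import Data.Nat.Primality.Factorisation using (factorise)
  open import Data.Nat.Tactic.RingSolver using (solve-∀)
  open import Data.Nat.Combinatorics using (_C_; nC1≡n; nCk+nC[k+1]≡[n+1]C[k+1])
  open import Data.Nat.ListAction using (product)
  open import Data.List using (List; []; _∷_; map)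
  open import Data.List.Relation.Unary.All using (All; []; _∷_)
  import Data.List.Relation.Unary.All as All
  import Data.List.Relation.Unary.All.Properties as All
  open import Data.List.Relation.Unary.AllPairs using (AllPairs; []; _∷_)
  open import Data.Nat.ListAction.Properties using (product≢0)
  open import Data.Product using (∃₂; _×_; _,_)
  open import Data.Sum using (inj₁; inj₂)
  open import Relation.Binary.PropositionalEquality
  open import Relation.Nullary using (¬_; yes; no; contradiction)
  open import Algebra.Properties.CommutativeSemigroup *-commutativeSemigroup
    using (interchange; x∙yz≈y∙xz)

  pairwiseProduct : (ℕ → ℕ → ℕ) → List ℕ → ℕ
  pairwiseProduct f []       = 1
  pairwiseProduct f (x ∷ xs) = product (map (f x) xs) * pairwiseProduct f xs

  pairwiseProduct-∣ : ∀ {f g} → (∀ x y → f x y ∣ g x y) → ∀ xs → pairwiseProduct f xs ∣ pairwiseProduct g xs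
  pairwiseProduct-∣ f∣g []       = ∣-refl
  pairwiseProduct-∣ {f} {g} f∣g (x ∷ xs) = *-pres-∣ (row xs) (pairwiseProduct-∣ f∣g xs)
    where
    row : ∀ ys → product (map (f x) ys) ∣ product (map (g x) ys)
    row []       = ∣-refl
    row (y ∷ ys) = *-pres-∣ (f∣g x y) (row ys)

  pairwiseProduct-nonZero : ∀ {f} {xs} → AllPairs (λ x y → NonZero (f x y)) xs → NonZero (pairwiseProduct f xs)
  pairwiseProduct-nonZero []         = _
  pairwiseProduct-nonZero {f} {x ∷ xs} (fx≢0 ∷ fxs≢0) =
    m*n≢0 _ _ {{product≢0 (All.map⁺ fx≢0)}} {{pairwiseProduct-nonZero fxs≢0}}

  ∣-∣-pres-∣ : ∀ {d x y} → d ∣ x → d ∣ y → d ∣ ∣ x - y ∣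
  ∣-∣-pres-∣ {d} {x} {y} d∣x d∣y with ≤-total x y
  ... | inj₁ x≤y rewrite m≤n⇒∣m-n∣≡n∸m x≤y = ∣m+n∣m⇒∣n (subst (d ∣_) (sym (m+[n∸m]≡n x≤y)) d∣y) d∣x
  ... | inj₂ y≤x rewrite m≤n⇒∣n-m∣≡n∸m y≤x = ∣m+n∣m⇒∣n (subst (d ∣_) (sym (m+[n∸m]≡n y≤x)) d∣x) d∣y

  gcd∣∣-∣ : ∀ x y → gcd x y ∣ ∣ x - y ∣
  gcd∣∣-∣ x y = ∣-∣-pres-∣ (gcd[m,n]∣m x y) (gcd[m,n]∣n x y)

  [1+n]C2≡n+nC2 : ∀ n → suc n C 2 ≡ n + n C 2
  [1+n]C2≡n+nC2 n = trans (sym (nCk+nC[k+1]≡[n+1]C[k+1] n 1)) (cong (_+ n C 2) (nC1≡n n))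

  ^-distribʳ-* : ∀ m n o → (m * n) ^ o ≡ m ^ o * n ^ o
  ^-distribʳ-* m n zero    = refl
  ^-distribʳ-* m n (suc o) = trans (cong (m * n *_) (^-distribʳ-* m n o)) (interchange m n (m ^ o) (n ^ o))

  *≤[1+m]C2+nC2 : ∀ m n → n * m ≤ suc m C 2 + n C 2
  *≤[1+m]C2+nC2 m       zero    = z≤n
  *≤[1+m]C2+nC2 zero    (suc n) = ≤-trans (≤-reflexive (*-zeroʳ n)) z≤n
  *≤[1+m]C2+nC2 (suc m) (suc n) = begin
    suc m + n * suc m                        ≡⟨ cong (suc m +_) (*-suc n m) ⟩
    suc m + (n + n * m)                      ≤⟨ +-monoʳ-≤ (suc m) (+-monoʳ-≤ n (*≤[1+m]C2+nC2 m n)) ⟩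
    suc m + (n + (suc m C 2 + n C 2))        ≡⟨ regroup (suc m) (suc m C 2) n (n C 2) ⟩
    (suc m + suc m C 2) + (n + n C 2)        ≡⟨ cong₂ _+_ ([1+n]C2≡n+nC2 (suc m)) ([1+n]C2≡n+nC2 n) ⟨
    suc (suc m) C 2 + suc n C 2              ∎
    where
    open ≤-Reasoning
    regroup : ∀ a b c d → a + (c + (b + d)) ≡ (a + b) + (c + d)
    regroup = solve-∀

  data DivideSome (p : ℕ) : ℕ → List ℕ → List ℕ → Set where
    []     : DivideSome p 0 [] []
    keep   : ∀ {n x xs ys} → DivideSome p n xs ys → DivideSome p n (x ∷ xs) (x ∷ ys)
    divide : ∀ {n x xs ys} → DivideSome p n xs ys → DivideSome p (suc n) (p * x ∷ xs) (x ∷ ys)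

  prime∤⇒coprime : ∀ {p x} → Prime p → ¬ p ∣ x → Coprime x p
  prime∤⇒coprime p-prime p∤x (d∣x , d∣p) with prime⇒irreducible p-prime d∣p
  ... | inj₁ d≡1 = d≡1
  ... | inj₂ refl = contradiction d∣x p∤x

  divide-by-prime : ∀ {p m} → Prime p → ∀ {xs} → All (_∣ p * m) xs →
                    ∃₂ λ n ys → DivideSome p n xs ys × All (_∣ m) ys
  divide-by-prime p-prime [] = 0 , [] , [] , []
  divide-by-prime {p} {m} p-prime {x ∷ xs} (x∣pm ∷ xs∣pm)
    with divide-by-prime p-prime xs∣pm | p ∣? x
  ... | n , ys , div , ys∣m | no p∤x =
    n , x ∷ ys , keep div , coprime-divisor (prime∤⇒coprime p-prime p∤x) x∣pm ∷ ys∣m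
  ... | n , ys , div , ys∣m | yes (divides y refl) =
    suc n , y ∷ ys , subst (λ z → DivideSome p (suc n) (z ∷ xs) (y ∷ ys)) (*-comm p y) (divide div) ,
    *-cancelˡ-∣ p {{prime⇒nonZero p-prime}} (subst (_∣ p * m) (*-comm y p) x∣pm) ∷ ys∣m

  product-^-divideSome : ∀ {p n xs ys} α → DivideSome p n xs ys →
                         product (map (_^ α) xs) ≡ p ^ (n * α) * product (map (_^ α) ys)
  product-^-divideSome α [] = refl
  product-^-divideSome {p} {n} α (keep {x = x} {xs} {ys} div) = begin
    x ^ α * product (map (_^ α) xs)             ≡⟨ cong (x ^ α *_) (product-^-divideSome α div) ⟩
    x ^ α * (p ^ (n * α) * product (map (_^ α) ys)) ≡⟨ x∙yz≈y∙xz (x ^ α) (p ^ (n * α)) _ ⟩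
    p ^ (n * α) * (x ^ α * product (map (_^ α) ys)) ∎
    where open ≡-Reasoning
  product-^-divideSome {p} {suc n} α (divide {x = x} {xs} {ys} div) = begin
    (p * x) ^ α * product (map (_^ α) xs)                ≡⟨ cong₂ _*_ (^-distribʳ-* p x α) (product-^-divideSome α div) ⟩
    (p ^ α * x ^ α) * (p ^ (n * α) * product (map (_^ α) ys)) ≡⟨ interchange (p ^ α) (x ^ α) _ _ ⟩
    (p ^ α * p ^ (n * α)) * (x ^ α * product (map (_^ α) ys)) ≡⟨ cong (_* _) (^-distribˡ-+-* p α (n * α)) ⟨
    p ^ (α + n * α) * (x ^ α * product (map (_^ α) ys))   ∎
    where open ≡-Reasoning

  gcd-row-keep : ∀ {p n xs ys} x → DivideSome p n xs ys →
                 product (map (gcd x) ys) ∣ product (map (gcd x) xs)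
  gcd-row-keep x []                    = ∣-refl
  gcd-row-keep x (keep {x = y} div)    = *-monoʳ-∣ (gcd x y) (gcd-row-keep x div)
  gcd-row-keep {p} x (divide {x = y} div) =
    *-pres-∣ (gcd-greatest (gcd[m,n]∣m x y) (∣n⇒∣m*n p (gcd[m,n]∣n x y))) (gcd-row-keep x div)

  gcd-row-divide : ∀ {p n xs ys} x → DivideSome p n xs ys →
                   p ^ n * product (map (gcd x) ys) ∣ product (map (gcd (p * x)) xs)
  gcd-row-divide x [] = ∣-refl
  gcd-row-divide {p} {n} x (keep {x = y} {xs} {ys} div) = begin
    p ^ n * (gcd x y * product (map (gcd x) ys))  ≡⟨ x∙yz≈y∙xz (p ^ n) (gcd x y) _ ⟩
    gcd x y * (p ^ n * product (map (gcd x) ys))  ∣⟨ *-pres-∣ gcd∣gcd (gcd-row-divide x div) ⟩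
    gcd (p * x) y * product (map (gcd (p * x)) xs) ∎
    where
    open ∣-Reasoning
    gcd∣gcd = gcd-greatest (∣n⇒∣m*n p (gcd[m,n]∣m x y)) (gcd[m,n]∣n x y)
  gcd-row-divide {p} x (divide {n} {y} {xs} {ys} div) = begin
    p * p ^ n * (gcd x y * product (map (gcd x) ys))        ≡⟨ interchange p (p ^ n) (gcd x y) _ ⟩
    p * gcd x y * (p ^ n * product (map (gcd x) ys))        ≡⟨ cong (_* _) (c*gcd[m,n]≡gcd[cm,cn] p x y) ⟩
    gcd (p * x) (p * y) * (p ^ n * product (map (gcd x) ys)) ∣⟨ *-monoʳ-∣ (gcd (p * x) (p * y)) (gcd-row-divide x div) ⟩
    gcd (p * x) (p * y) * product (map (gcd (p * x)) xs)    ∎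
    where open ∣-Reasoning

  pairwise-gcd-divideSome : ∀ {p n xs ys} → DivideSome p n xs ys →
                            p ^ (n C 2) * pairwiseProduct gcd ys ∣ pairwiseProduct gcd xs
  pairwise-gcd-divideSome [] = ∣-refl
  pairwise-gcd-divideSome {p} {n} (keep {x = x} {xs} {ys} div) = begin
    p ^ (n C 2) * (product (map (gcd x) ys) * pairwiseProduct gcd ys)
      ≡⟨ x∙yz≈y∙xz (p ^ (n C 2)) (product (map (gcd x) ys)) (pairwiseProduct gcd ys) ⟩
    product (map (gcd x) ys) * (p ^ (n C 2) * pairwiseProduct gcd ys)
      ∣⟨ *-pres-∣ (gcd-row-keep x div) (pairwise-gcd-divideSome div) ⟩
    product (map (gcd x) xs) * pairwiseProduct gcd xs
      ∎
    where open ∣-Reasoning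
  pairwise-gcd-divideSome {p} (divide {n} {x} {xs} {ys} div) = begin
    p ^ (suc n C 2) * (product (map (gcd x) ys) * pairwiseProduct gcd ys)
      ≡⟨ cong (λ e → p ^ e * _) ([1+n]C2≡n+nC2 n) ⟩
    p ^ (n + n C 2) * (product (map (gcd x) ys) * pairwiseProduct gcd ys)
      ≡⟨ cong (_* _) (^-distribˡ-+-* p n (n C 2)) ⟩
    p ^ n * p ^ (n C 2) * (product (map (gcd x) ys) * pairwiseProduct gcd ys)
      ≡⟨ interchange (p ^ n) (p ^ (n C 2)) _ _ ⟩
    (p ^ n * product (map (gcd x) ys)) * (p ^ (n C 2) * pairwiseProduct gcd ys)
      ∣⟨ *-pres-∣ (gcd-row-divide x div) (pairwise-gcd-divideSome div) ⟩
    product (map (gcd (p * x)) xs) * pairwiseProduct gcd xs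
      ∎
    where open ∣-Reasoning

  private
    product-^-∣1 : ∀ α {xs} → All (_∣ 1) xs → product (map (_^ α) xs) ≡ 1
    product-^-∣1 α []                 = refl
    product-^-∣1 α (x∣1 ∷ xs∣1) rewrite ∣1⇒≡1 x∣1 | ^-zeroˡ α | product-^-∣1 α xs∣1 = refl

    -- Peeling a prime p off m divides n of the xᵢ by p; the lost factor p^(nα) is made up by p^((α+1) C 2)
    -- from the power of m and p^(n C 2) from the gcds among the n divided entries, as nα ≤ (α+1) C 2 + n C 2.
    product-^-∣-primes : ∀ α {fs} → All Prime fs → ∀ {xs} → All (_∣ product fs) xs →
                         product (map (_^ α) xs) ∣ product fs ^ (suc α C 2) * pairwiseProduct gcd xs
    product-^-∣-primes α [] xs∣1 rewrite product-^-∣1 α xs∣1 = 1∣ _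
    product-^-∣-primes α {p ∷ fs} (p-prime ∷ fs-prime) {xs} xs∣pm
      with divide-by-prime p-prime xs∣pm
    ... | n , ys , div , ys∣m = begin
      product (map (_^ α) xs)                         ≡⟨ product-^-divideSome α div ⟩
      p ^ (n * α) * product (map (_^ α) ys)                   ∣⟨ *-pres-∣ p^nα∣ (product-^-∣-primes α fs-prime ys∣m) ⟩
      p ^ (A + n C 2) * (m ^ A * G)                            ≡⟨ cong (_* (m ^ A * G)) (^-distribˡ-+-* p A (n C 2)) ⟩
      p ^ A * p ^ (n C 2) * (m ^ A * G)                        ≡⟨ interchange (p ^ A) (p ^ (n C 2)) (m ^ A) G ⟩
      p ^ A * m ^ A * (p ^ (n C 2) * G)                        ≡⟨ cong (_* (p ^ (n C 2) * G)) (^-distribʳ-* p m A) ⟨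
      (p * m) ^ A * (p ^ (n C 2) * G)                          ∣⟨ *-monoʳ-∣ ((p * m) ^ A) (pairwise-gcd-divideSome div) ⟩
      (p * m) ^ A * pairwiseProduct gcd xs                     ∎
      where
      open ∣-Reasoning
      m = product fs
      A = suc α C 2
      G = pairwiseProduct gcd ys
      p^nα∣ : p ^ (n * α) ∣ p ^ (A + n C 2)
      p^nα∣ = divides (p ^ (A + n C 2 ∸ n * α))
        (trans (cong (p ^_) (sym (m∸n+n≡m (*≤[1+m]C2+nC2 α n)))) (^-distribˡ-+-* p (A + n C 2 ∸ n * α) (n * α)))

  product-^-∣-pairwise-gcd : ∀ α {m} .{{_ : NonZero m}} {xs} → All (_∣ m) xs →
                             product (map (_^ α) xs) ∣ m ^ (suc α C 2) * pairwiseProduct gcd xs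
  product-^-∣-pairwise-gcd α {m} {xs} xs∣m with factorise m
  ... | record { factors = fs ; isFactorisation = m≡∏fs ; factorsPrime = fs-prime } =
    subst (λ z → product (map (_^ α) xs) ∣ z ^ (suc α C 2) * pairwiseProduct gcd xs) (sym m≡∏fs)
      (product-^-∣-primes α fs-prime (All.map (λ x∣m → subst (_ ∣_) m≡∏fs x∣m) xs∣m))

module DivisorsInInterval where

  open import Data.Nat as ℕ using (ℕ; suc; NonZero; ∣_-_∣)
  import Data.Nat.Properties as ℕP
  open import Data.Nat.Combinatorics using (_C_)
  open import Data.Nat.Divisibility using (_∣_; _∣?_; ∣⇒≤; ∣-trans; *-monoʳ-∣)
  open import Data.Nat.ListAction using (product)
  open import Data.Rational as ℚ using (ℚ; 0ℚ; _+_; _*_; _≤_)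
  import Data.Rational.Properties as ℚP
  open import Data.List using (List; []; _∷_; map; length; filter; take; upTo)
  import Data.List.Properties as List
  open import Data.List.Relation.Unary.All using (All; []; _∷_)
  import Data.List.Relation.Unary.All as All
  import Data.List.Relation.Unary.All.Properties as All
  import Data.List.Relation.Unary.AllPairs as AllPairs
  open import Data.List.Relation.Unary.Unique.Propositional using (Unique)
  import Data.List.Relation.Unary.Unique.Propositional.Properties as Unique
  open import Data.Product using (_×_; _,_; ∃-syntax)
  open import Relation.Nullary.Decidable using (_×-dec_)
  open import Relation.Unary using (Decidable)
  open import Data.Sum using (inj₁; inj₂)
  open import Relation.Binary.PropositionalEquality
  open import Function using (_∘_)
  open RationalOrder
  open ℕ→ℚ-Properties
  open RationalPower
  open PairwiseGcd

  ℕ→ℚ-product-≥ : ∀ {a} → 0ℚ ≤ a → ∀ {xs} → All (λ x → a ≤ ℕ→ℚ x) xs →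
                  a ^ length xs ≤ ℕ→ℚ (product xs)
  ℕ→ℚ-product-≥ 0≤a []                 = ℚP.≤-refl
  ℕ→ℚ-product-≥ {a} 0≤a {x ∷ xs} (a≤x ∷ a≤xs) = begin
    a * a ^ length xs
      ≤⟨ *-mono-≤-nonNeg 0≤a (^-nonNeg (length xs) 0≤a) a≤x (ℕ→ℚ-product-≥ 0≤a a≤xs) ⟩
    ℕ→ℚ x * ℕ→ℚ (product xs)         ≡⟨ ℕ→ℚ-homo-* x (product xs) ⟨
    ℕ→ℚ (x ℕ.* product xs)           ∎
    where open ℚP.≤-Reasoning

  ℕ→ℚ-product-≤ : ∀ {w xs} → All (λ x → ℕ→ℚ x ≤ w) xs → ℕ→ℚ (product xs) ≤ w ^ length xs
  ℕ→ℚ-product-≤ []                 = ℚP.≤-refl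
  ℕ→ℚ-product-≤ {w} {x ∷ xs} (x≤w ∷ xs≤w) = begin
    ℕ→ℚ (x ℕ.* product xs)           ≡⟨ ℕ→ℚ-homo-* x (product xs) ⟩
    ℕ→ℚ x * ℕ→ℚ (product xs)
      ≤⟨ *-mono-≤-nonNeg (ℕ→ℚ-nonNeg x) (ℕ→ℚ-nonNeg (product xs)) x≤w (ℕ→ℚ-product-≤ xs≤w) ⟩
    w * w ^ length xs                ∎
    where open ℚP.≤-Reasoning

  pairwiseProduct-≤ : ∀ {P : ℕ → Set} {f w} → (∀ x y → P x → P y → ℕ→ℚ (f x y) ≤ w) →
                      ∀ {xs} → All P xs → ℕ→ℚ (pairwiseProduct f xs) ≤ w ^ (length xs C 2)
  pairwiseProduct-≤ f≤w []                    = ℚP.≤-refl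
  pairwiseProduct-≤ {f = f} {w} f≤w {x ∷ xs} (px ∷ pxs) = begin
    ℕ→ℚ (product (map (f x) xs) ℕ.* pairwiseProduct f xs)
      ≡⟨ ℕ→ℚ-homo-* (product (map (f x) xs)) (pairwiseProduct f xs) ⟩
    ℕ→ℚ (product (map (f x) xs)) * ℕ→ℚ (pairwiseProduct f xs)
      ≤⟨ *-mono-≤-nonNeg (ℕ→ℚ-nonNeg (product (map (f x) xs))) (ℕ→ℚ-nonNeg (pairwiseProduct f xs))
           (ℕ→ℚ-product-≤ row≤w) (pairwiseProduct-≤ {f = f} f≤w pxs) ⟩
    w ^ length (map (f x) xs) * w ^ (length xs C 2)
      ≡⟨ cong (λ n → w ^ n * w ^ (length xs C 2)) (List.length-map (f x) xs) ⟩
    w ^ length xs * w ^ (length xs C 2)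
      ≡⟨ ^-homo-* w (length xs) (length xs C 2) ⟨
    w ^ (length xs ℕ.+ length xs C 2)
      ≡⟨ cong (w ^_) ([1+n]C2≡n+nC2 (length xs)) ⟨
    w ^ (suc (length xs) C 2)
      ∎
    where
    open ℚP.≤-Reasoning
    row≤w : All (λ z → ℕ→ℚ z ≤ w) (map (f x) xs)
    row≤w = All.map⁺ (All.map (f≤w x _ px) pxs)

  _∈[_,_] : ℕ → ℚ → ℚ → Set
  d ∈[ a , b ] = a ≤ ℕ→ℚ d × ℕ→ℚ d ≤ b

  private
    ∸-≤-width : ∀ {a w x y} → x ℕ.≤ y → x ∈[ a , a + w ] → y ∈[ a , a + w ] → ℕ→ℚ (y ℕ.∸ x) ≤ w
    ∸-≤-width x≤y (a≤x , _) (_ , y≤a+w) = +-≤-+-cancelˡ (subst (_≤ _) (ℕ→ℚ-+-∸ x≤y) y≤a+w) a≤x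

  ∣-∣-≤-width : ∀ {a w} x y → x ∈[ a , a + w ] → y ∈[ a , a + w ] → ℕ→ℚ ∣ x - y ∣ ≤ w
  ∣-∣-≤-width x y x∈ y∈ with ℕP.≤-total x y
  ... | inj₁ x≤y rewrite ℕP.m≤n⇒∣m-n∣≡n∸m x≤y = ∸-≤-width x≤y x∈ y∈
  ... | inj₂ y≤x rewrite ℕP.m≤n⇒∣n-m∣≡n∸m y≤x = ∸-≤-width y≤x y∈ x∈

  divisors-in-interval : ∀ α {m} .{{_ : NonZero m}} {a w xs} → 0ℚ ≤ a →
                         Unique xs → All (_∣ m) xs → All (_∈[ a , a + w ]) xs →
                         a ^ (α ℕ.* length xs) ≤ ℕ→ℚ m ^ (suc α C 2) * w ^ (length xs C 2)
  divisors-in-interval α {m} {a} {w} {xs} 0≤a distinct xs∣m xs∈ = begin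
    a ^ (α ℕ.* length xs)                       ≡⟨ ^-assocʳ a α (length xs) ⟨
    (a ^ α) ^ length xs                         ≡⟨ cong ((a ^ α) ^_) (List.length-map (ℕ._^ α) xs) ⟨
    (a ^ α) ^ length (map (ℕ._^ α) xs)
      ≤⟨ ℕ→ℚ-product-≥ (^-nonNeg α 0≤a) (All.map⁺ (All.map a^α≤ xs∈)) ⟩
    ℕ→ℚ (product (map (ℕ._^ α) xs))             ≤⟨ ℕ→ℚ-mono-≤ (∣⇒≤ {{nonZero}} powers∣) ⟩
    ℕ→ℚ (m ℕ.^ A ℕ.* pairwiseProduct ∣_-_∣ xs)  ≡⟨ ℕ→ℚ-homo-* (m ℕ.^ A) _ ⟩
    ℕ→ℚ (m ℕ.^ A) * ℕ→ℚ (pairwiseProduct ∣_-_∣ xs)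
      ≡⟨ cong (_* ℕ→ℚ (pairwiseProduct ∣_-_∣ xs)) (ℕ→ℚ-homo-^ m A) ⟩
    ℕ→ℚ m ^ A * ℕ→ℚ (pairwiseProduct ∣_-_∣ xs)
      ≤⟨ ℚP.*-monoˡ-≤-nonNeg (ℕ→ℚ m ^ A) {{ℚ.nonNegative (^-nonNeg A (ℕ→ℚ-nonNeg m))}}
           (pairwiseProduct-≤ {f = ∣_-_∣} ∣-∣-≤-width xs∈) ⟩
    ℕ→ℚ m ^ A * w ^ (length xs C 2)              ∎
    where
    open ℚP.≤-Reasoning
    A = suc α C 2
    a^α≤ : ∀ {x} → x ∈[ a , a + w ] → a ^ α ≤ ℕ→ℚ (x ℕ.^ α)
    a^α≤ {x} (a≤x , _) = subst (a ^ α ≤_) (sym (ℕ→ℚ-homo-^ x α)) (^-monoˡ-≤ α 0≤a a≤x)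
    powers∣ : product (map (ℕ._^ α) xs) ∣ m ℕ.^ A ℕ.* pairwiseProduct ∣_-_∣ xs
    powers∣ = ∣-trans (product-^-∣-pairwise-gcd α xs∣m) (*-monoʳ-∣ (m ℕ.^ A) (pairwiseProduct-∣ gcd∣∣-∣ xs))
    nonZero : NonZero (m ℕ.^ A ℕ.* pairwiseProduct ∣_-_∣ xs)
    nonZero = ℕP.m*n≢0 _ _ {{ℕP.m^n≢0 m A}}
      {{pairwiseProduct-nonZero (AllPairs.map (λ x≢y → ℕ.≢-nonZero (x≢y ∘ ℕP.∣m-n∣≡0⇒m≡n)) distinct)}}

  r≤τ⇒divisors : ∀ {r m a b} → r ℕ.≤ τ m a b →
                 ∃[ xs ] (length xs ≡ r × Unique xs × All (_∣ m) xs × All (_∈[ a , b ]) xs)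
  r≤τ⇒divisors {r} {m} {a} {b} r≤τ =
    xs , length-xs , distinct , All.unzip (All.take⁺ r (All.all-filter inInterval? candidates))
    where
    inInterval? : Decidable (λ d → d ∣ m × d ∈[ a , b ])
    inInterval? d = (d ∣? m) ×-dec ((a ℚ.≤? ℕ→ℚ d) ×-dec (ℕ→ℚ d ℚ.≤? b))
    candidates : List ℕ
    candidates = map suc (upTo m)
    xs : List ℕ
    xs = take r (filter inInterval? candidates)
    length-xs : length xs ≡ r
    length-xs = trans (List.length-take r _) (ℕP.m≤n⇒m⊓n≡m r≤τ)
    distinct : Unique xs
    distinct = Unique.take⁺ r (Unique.filter⁺ inInterval? (Unique.map⁺ ℕP.suc-injective (Unique.upTo⁺ m)))

module Golden where

  open import Data.Nat
  open import Data.Nat.Properties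
  open import Data.Nat.Combinatorics using (_C_)
  open import Data.Nat.Tactic.RingSolver using (solve-∀)
  open import Data.Product using (_×_; _,_; ∃-syntax)
  open import Relation.Binary.PropositionalEquality
  open import Relation.Nullary using (¬_; yes; no; contradiction)
  open import Relation.Unary using (Decidable)
  open PairwiseGcd using ([1+n]C2≡n+nC2)

  -- γ₀ = (√5 − 1)/2 is the positive root of t² + t = 1, so this says a ≤ γ₀ r.
  _≤γ₀*_ : ℕ → ℕ → Set
  a ≤γ₀* r = a * a + a * r ≤ r * r

  last-before-failure : (P : ℕ → Set) → Decidable P → P 0 → ∀ n → ¬ P n → ∃[ a ] (P a × ¬ P (suc a))
  last-before-failure P P? p0 zero    ¬pn = contradiction p0 ¬pn
  last-before-failure P P? p0 (suc n) ¬pn with P? n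
  ... | yes pn = n , pn , ¬pn
  ... | no ¬pn′ = last-before-failure P P? p0 n ¬pn′

  largest-≤γ₀* : ∀ r → 2 ≤ r → ∃[ β ] (suc β ≤γ₀* r × ¬ suc (suc β) ≤γ₀* r)
  largest-≤γ₀* r 2≤r = last-before-failure (λ b → suc b ≤γ₀* r) (λ b → _ ≤? _) 1≤γ₀*r r ¬[1+r]≤γ₀*r
    where
    1≤γ₀*r : 1 ≤γ₀* r
    1≤γ₀*r = begin
      1 * 1 + 1 * r  ≡⟨ cong (1 +_) (*-identityˡ r) ⟩
      1 + r          ≤⟨ +-monoˡ-≤ r (≤-trans (s≤s z≤n) 2≤r) ⟩
      r + r          ≡⟨ cong (r +_) (+-identityʳ r) ⟨
      2 * r          ≤⟨ *-monoˡ-≤ r 2≤r ⟩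
      r * r          ∎
      where open ≤-Reasoning
    ¬[1+r]≤γ₀*r : ¬ suc r ≤γ₀* r
    ¬[1+r]≤γ₀*r = <⇒≱ (begin-strict
      r * r                              <⟨ *-mono-< (n<1+n r) (n<1+n r) ⟩
      suc r * suc r                      ≤⟨ m≤m+n (suc r * suc r) (suc r * r) ⟩
      suc r * suc r + suc r * r          ∎)
      where open ≤-Reasoning

  2*nC2+n≡n*n : ∀ n → 2 * (n C 2) + n ≡ n * n
  2*nC2+n≡n*n zero    = refl
  2*nC2+n≡n*n (suc n) = begin
    2 * (suc n C 2) + suc n          ≡⟨ cong (λ c → 2 * c + suc n) ([1+n]C2≡n+nC2 n) ⟩
    2 * (n + n C 2) + suc n          ≡⟨ regroup n (n C 2) ⟩
    (2 * (n C 2) + n) + (suc n + n)  ≡⟨ cong (_+ (suc n + n)) (2*nC2+n≡n*n n) ⟩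
    n * n + (suc n + n)              ≡⟨ square n ⟩
    suc n * suc n                    ∎
    where
    open ≡-Reasoning
    regroup : ∀ n c → 2 * (n + c) + suc n ≡ (2 * c + n) + (suc n + n)
    regroup = solve-∀
    square : ∀ n → n * n + (suc n + n) ≡ suc n * suc n
    square = solve-∀

  module Exponents (r β : ℕ) where

    α = suc β
    A = suc α C 2
    Y = A + r C 2

    instance
      Y-nonZero : NonZero Y
      Y-nonZero = >-nonZero (≤-trans (≤-trans (s≤s z≤n) (≤-reflexive (sym ([1+n]C2≡n+nC2 α)))) (m≤m+n A (r C 2)))

    -- That is, (rα − A)/Y ≥ β/r. With δ = r² − α² − αr ≥ 0 one has 2(βY + rA) + αδ + α + 2 (r C 2) = 2r²α;
    -- the identity is checked after adding (β + r)(1 + α) + αr to both sides, which turns 2A and 2 (r C 2) into squares.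
    β*Y+r*A≤r*r*α : α ≤γ₀* r → β * Y + r * A ≤ r * r * α
    β*Y+r*A≤r*r*α α≤γ₀*r = *-cancelˡ-≤ 2 (≤-trans (m≤m+n _ slack) (≤-reflexive identity))
      where
      R = r C 2
      δ = r * r ∸ (α * α + α * r)
      S = α * α + α * r + δ
      r*r≡S : r * r ≡ S
      r*r≡S = sym (m+[n∸m]≡n α≤γ₀*r)
      slack = α * δ + α + 2 * R
      E = (β + r) * suc α + α * r
      expand : ∀ β r δ A R → let α = 1 + β in
               2 * (β * (A + R) + r * A) + (α * δ + α + 2 * R) + ((β + r) * (1 + α) + α * r)
                 ≡ (β + r) * (2 * A + (1 + α)) + α * (2 * R + r) + α * δ + α
      expand = solve-∀
      collapse : ∀ β r δ → let α = 1 + β; S = α * α + α * r + δ in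
                 (β + r) * ((1 + α) * (1 + α)) + α * S + α * δ + α ≡ 2 * (S * α) + ((β + r) * (1 + α) + α * r)
      collapse = solve-∀
      identity : 2 * (β * Y + r * A) + slack ≡ 2 * (r * r * α)
      identity = +-cancelʳ-≡ E _ _ (begin
        2 * (β * Y + r * A) + slack + E                           ≡⟨ expand β r δ A R ⟩
        (β + r) * (2 * A + suc α) + α * (2 * R + r) + α * δ + α   ≡⟨ cong₂ (λ u v → (β + r) * u + α * v + α * δ + α)
                                                                        (2*nC2+n≡n*n (suc α)) (trans (2*nC2+n≡n*n r) r*r≡S) ⟩
        (β + r) * (suc α * suc α) + α * S + α * δ + α             ≡⟨ collapse β r δ ⟩
        2 * (S * α) + E                                           ≡⟨ cong (λ u → 2 * (u * α) + E) r*r≡S ⟨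
        2 * (r * r * α) + E                                       ∎)
        where open ≡-Reasoning

module ExponentBound where

  open import Data.Nat as ℕ using (ℕ; suc; NonZero)
  import Data.Nat.Properties as ℕP
  open import Data.Integer as ℤ using (+_)
  open import Data.Rational as ℚ using (0ℚ; 1ℚ; _+_; _*_; _/_; _≤_; _<_)
  import Data.Rational.Properties as ℚP
  open import Data.Rational.Solver using (module +-*-Solver)
  open import Data.Sum using (inj₁; inj₂)
  open import Relation.Binary.PropositionalEquality
  open import Relation.Nullary using (¬_; yes; no; contradiction)
  open RationalOrder
  open ℕ→ℚ-Properties
  open Golden
  open +-*-Solver

  LtGamma0⇒*-< : ∀ {t ρ g} → LtGamma0 t → 0ℚ < ρ → 0ℚ ≤ g → ρ * ρ < g * g + g * ρ → t * ρ < g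
  LtGamma0⇒*-< {t} {ρ} {g} (inj₁ t<0) 0<ρ 0≤g _ = begin-strict
    t * ρ   <⟨ ℚP.*-monoˡ-<-pos ρ {{ℚ.positive 0<ρ}} t<0 ⟩
    0ℚ * ρ  ≡⟨ ℚP.*-zeroˡ ρ ⟩
    0ℚ      ≤⟨ 0≤g ⟩
    g       ∎
    where open ℚP.≤-Reasoning
  LtGamma0⇒*-< {t} {ρ} {g} (inj₂ t²+t<1) 0<ρ 0≤g ρ²<g²+gρ with t * ρ ℚ.<? g
  ... | yes tρ<g = tρ<g
  ... | no tρ≮g  = contradiction ρ²<g²+gρ (ℚP.<-asym (begin-strict
    g * g + g * ρ               ≤⟨ ℚP.+-mono-≤ (*-mono-≤-nonNeg 0≤g 0≤g g≤tρ g≤tρ)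
                                                (ℚP.*-monoʳ-≤-nonNeg ρ {{ℚ.nonNegative (ℚP.<⇒≤ 0<ρ)}} g≤tρ) ⟩
    t * ρ * (t * ρ) + t * ρ * ρ ≡⟨ solve 2 (λ t ρ → t :* ρ :* (t :* ρ) :+ t :* ρ :* ρ := (t :* t :+ t) :* (ρ :* ρ))
                                            refl t ρ ⟩
    (t * t + t) * (ρ * ρ)       <⟨ ℚP.*-monoˡ-<-pos (ρ * ρ) {{ℚ.positive (*-pos 0<ρ 0<ρ)}} t²+t<1 ⟩
    1ℚ * (ρ * ρ)                ≡⟨ ℚP.*-identityˡ (ρ * ρ) ⟩
    ρ * ρ                       ∎))
    where
    open ℚP.≤-Reasoning
    g≤tρ = ℚP.≮⇒≥ tρ≮g

  module _ (r β : ℕ) .{{_ : NonZero r}} where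

    open Exponents r β

    -- That is, s < (rα − A)/Y for s = (b − a)/q: s + 2/r < γ₀ < (α + 1)/r gives s r < β, and β/r ≤ (rα − A)/Y.
    exponent-bound : α ≤γ₀* r → ¬ suc α ≤γ₀* r →
                     ∀ a b q → LtGamma0 ((+ b ℤ.- + a) / suc q + ℕ→ℚ 2 * recip r) →
                     A ℕ.* suc q ℕ.+ b ℕ.* Y ℕ.< r ℕ.* α ℕ.* suc q ℕ.+ a ℕ.* Y
    exponent-bound α≤γ₀*r α+1≰γ₀*r a b q t<γ₀ = ℕ→ℚ-cancel-< (begin-strict
      ℕ→ℚ (A ℕ.* Q ℕ.+ b ℕ.* Y)        ≡⟨ ℕ→ℚ-homo-*+* A Q b Y ⟩
      A′ * Q′ + ℕ→ℚ b * Y′             ≡⟨ cong (λ z → A′ * Q′ + z * Y′) ([b-a]/q*q+a≡b a b q) ⟨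
      A′ * Q′ + (s * Q′ + a′) * Y′     ≡⟨ solve 5 (λ A Q s a Y → A :* Q :+ (s :* Q :+ a) :* Y
                                                             := (s :* Y :+ A) :* Q :+ a :* Y) refl A′ Q′ s a′ Y′ ⟩
      (s * Y′ + A′) * Q′ + a′ * Y′     <⟨ ℚP.+-monoˡ-< (a′ * Y′)
                                            (ℚP.*-monoˡ-<-pos Q′ {{ℚ.positive (ℕ→ℚ-pos Q)}} sY+A<rα) ⟩
      r′ * α′ * Q′ + a′ * Y′           ≡⟨ cong (_+ a′ * Y′) (cong (_* Q′) (ℕ→ℚ-homo-* r α)) ⟨
      ℕ→ℚ (r ℕ.* α) * Q′ + a′ * Y′     ≡⟨ ℕ→ℚ-homo-*+* (r ℕ.* α) Q a Y ⟨
      ℕ→ℚ (r ℕ.* α ℕ.* Q ℕ.+ a ℕ.* Y)  ∎)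
      where
      open ℚP.≤-Reasoning
      Q = suc q
      s = (+ b ℤ.- + a) / Q
      r′ = ℕ→ℚ r; α′ = ℕ→ℚ α; β′ = ℕ→ℚ β
      A′ = ℕ→ℚ A; Y′ = ℕ→ℚ Y; Q′ = ℕ→ℚ Q; a′ = ℕ→ℚ a
      0<r′ = ℕ→ℚ-pos r

      ℕ→ℚ-homo-*+* : ∀ m n u v → ℕ→ℚ (m ℕ.* n ℕ.+ u ℕ.* v) ≡ ℕ→ℚ m * ℕ→ℚ n + ℕ→ℚ u * ℕ→ℚ v
      ℕ→ℚ-homo-*+* m n u v =
        trans (ℕ→ℚ-homo-+ (m ℕ.* n) (u ℕ.* v)) (cong₂ _+_ (ℕ→ℚ-homo-* m n) (ℕ→ℚ-homo-* u v))

      r²<[1+α]²+[1+α]r : r′ * r′ < ℕ→ℚ (suc α) * ℕ→ℚ (suc α) + ℕ→ℚ (suc α) * r′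
      r²<[1+α]²+[1+α]r = begin-strict
        r′ * r′                                         ≡⟨ ℕ→ℚ-homo-* r r ⟨
        ℕ→ℚ (r ℕ.* r)                                   <⟨ ℕ→ℚ-mono-< (ℕP.≰⇒> α+1≰γ₀*r) ⟩
        ℕ→ℚ (suc α ℕ.* suc α ℕ.+ suc α ℕ.* r)           ≡⟨ ℕ→ℚ-homo-*+* (suc α) (suc α) (suc α) r ⟩
        ℕ→ℚ (suc α) * ℕ→ℚ (suc α) + ℕ→ℚ (suc α) * r′    ∎

      sr<β : s * r′ < β′
      sr<β = +-cancelʳ-< (begin-strict
        s * r′ + ℕ→ℚ 2                   ≡⟨ cong (λ z → s * r′ + z) (ℚP.*-identityʳ (ℕ→ℚ 2)) ⟨
        s * r′ + ℕ→ℚ 2 * 1ℚ              ≡⟨ cong (λ z → s * r′ + ℕ→ℚ 2 * z) (recip-inverseˡ r) ⟨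
        s * r′ + ℕ→ℚ 2 * (recip r * r′)  ≡⟨ solve 4 (λ s r c i → s :* r :+ c :* (i :* r) := (s :+ c :* i) :* r)
                                                refl s r′ (ℕ→ℚ 2) (recip r) ⟩
        (s + ℕ→ℚ 2 * recip r) * r′       <⟨ LtGamma0⇒*-< t<γ₀ 0<r′ (ℕ→ℚ-nonNeg (suc α)) r²<[1+α]²+[1+α]r ⟩
        ℕ→ℚ (suc α)                      ≡⟨ trans (cong ℕ→ℚ (ℕP.+-comm 2 β)) (ℕ→ℚ-homo-+ β 2) ⟩
        β′ + ℕ→ℚ 2                       ∎)

      sY+A<rα : s * Y′ + A′ < r′ * α′
      sY+A<rα = ℚP.*-cancelˡ-<-nonNeg r′ {{ℚ.nonNegative (ℚP.<⇒≤ 0<r′)}} (begin-strict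
        r′ * (s * Y′ + A′)           ≡⟨ solve 4 (λ r s Y A → r :* (s :* Y :+ A) := s :* r :* Y :+ r :* A)
                                                refl r′ s Y′ A′ ⟩
        s * r′ * Y′ + r′ * A′        <⟨ ℚP.+-monoˡ-< (r′ * A′)
                                          (ℚP.*-monoˡ-<-pos Y′ {{ℚ.positive (ℕ→ℚ-pos Y)}} sr<β) ⟩
        β′ * Y′ + r′ * A′            ≡⟨ ℕ→ℚ-homo-*+* β Y r A ⟨
        ℕ→ℚ (β ℕ.* Y ℕ.+ r ℕ.* A)    ≤⟨ ℕ→ℚ-mono-≤ (β*Y+r*A≤r*r*α α≤γ₀*r) ⟩
        ℕ→ℚ (r ℕ.* r ℕ.* α)          ≡⟨ trans (ℕ→ℚ-homo-* (r ℕ.* r) α)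
                                                (cong (_* α′) (ℕ→ℚ-homo-* r r)) ⟩
        r′ * r′ * α′                 ≡⟨ ℚP.*-assoc r′ r′ α′ ⟩
        r′ * (r′ * α′)               ∎)

module DivisorsNear2N where

  open import Data.Nat as ℕ using (suc; NonZero)
  import Data.Nat.Properties as ℕP
  open import Data.Nat.Combinatorics using (_C_)
  open import Data.Integer as ℤ using (+_)
  open import Data.Rational as ℚ using (ℚ; 0ℚ; 1ℚ; _+_; _*_; _/_; _≤_; _<_)
  import Data.Rational.Properties as ℚP
  open import Data.Product using (_,_)
  open import Relation.Binary.PropositionalEquality
  open RationalOrder
  open ℕ→ℚ-Properties
  open RationalPower
  open DivisorsInInterval

  c₀ : ℚ
  c₀ = + 1 / 6

  many-divisors⇒power-bound : ∀ α {r N m k} → .{{NonZero m}} → 0ℚ < k → ℕ→ℚ m ≤ ℕ→ℚ (3 ℕ.* N) * k →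
                              r ℕ.≤ τ m (ℕ→ℚ (2 ℕ.* N)) (ℕ→ℚ (2 ℕ.* N) + ℕ→ℚ 2 * k) →
                              ℕ→ℚ N ^ (r ℕ.* α) ≤ ℕ→ℚ N ^ (suc α C 2) * (ℕ→ℚ 6 * k) ^ (suc α C 2 ℕ.+ r C 2)
  many-divisors⇒power-bound α {r} {N} {m} {k} 0<k m≤3Nk r≤τ with r≤τ⇒divisors r≤τ
  ... | xs , refl , distinct , xs∣m , xs∈ = begin
    N′ ^ (r ℕ.* α)                         ≤⟨ ^-monoˡ-≤ (r ℕ.* α) (ℕ→ℚ-nonNeg N)
                                                 (ℕ→ℚ-mono-≤ (ℕP.m≤m+n N (N ℕ.+ 0))) ⟩
    ℕ→ℚ (2 ℕ.* N) ^ (r ℕ.* α)              ≡⟨ cong (ℕ→ℚ (2 ℕ.* N) ^_) (ℕP.*-comm r α) ⟩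
    ℕ→ℚ (2 ℕ.* N) ^ (α ℕ.* r)              ≤⟨ divisors-in-interval α (ℕ→ℚ-nonNeg (2 ℕ.* N))
                                                 distinct xs∣m xs∈ ⟩
    ℕ→ℚ m ^ A * (ℕ→ℚ 2 * k) ^ R            ≤⟨ *-mono-≤-nonNeg (^-nonNeg A (ℕ→ℚ-nonNeg m)) (^-nonNeg R 0≤2k)
                                                 (^-monoˡ-≤ A (ℕ→ℚ-nonNeg m) m≤NK) (^-monoˡ-≤ R 0≤2k 2k≤K) ⟩
    (N′ * K) ^ A * K ^ R                   ≡⟨ cong (_* K ^ R) (^-distrib-* N′ K A) ⟩
    N′ ^ A * K ^ A * K ^ R                 ≡⟨ ℚP.*-assoc (N′ ^ A) (K ^ A) (K ^ R) ⟩
    N′ ^ A * (K ^ A * K ^ R)               ≡⟨ cong (N′ ^ A *_) (^-homo-* K A R) ⟨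
    N′ ^ A * K ^ (A ℕ.+ R)                 ∎
    where
    open ℚP.≤-Reasoning
    N′ = ℕ→ℚ N
    K = ℕ→ℚ 6 * k
    A = suc α C 2
    R = r C 2
    0≤k = ℚP.<⇒≤ 0<k
    0≤2k = *-nonNeg (ℕ→ℚ-nonNeg 2) 0≤k
    2k≤K : ℕ→ℚ 2 * k ≤ K
    2k≤K = ℚP.*-monoʳ-≤-nonNeg k {{ℚ.nonNegative 0≤k}} (ℕ→ℚ-mono-≤ (ℕP.m≤m+n 2 4))
    m≤NK : ℕ→ℚ m ≤ N′ * K
    m≤NK = begin
      ℕ→ℚ m                     ≤⟨ m≤3Nk ⟩
      ℕ→ℚ (3 ℕ.* N) * k         ≤⟨ ℚP.*-monoʳ-≤-nonNeg k {{ℚ.nonNegative 0≤k}}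
                                     (ℕ→ℚ-mono-≤ (ℕP.*-monoˡ-≤ N (ℕP.m≤m+n 3 3))) ⟩
      ℕ→ℚ (6 ℕ.* N) * k         ≡⟨ cong (_* k) (ℕ→ℚ-homo-* 6 N) ⟩
      ℕ→ℚ 6 * N′ * k            ≡⟨ cong (_* k) (ℚP.*-comm (ℕ→ℚ 6) N′) ⟩
      N′ * ℕ→ℚ 6 * k            ≡⟨ ℚP.*-assoc N′ (ℕ→ℚ 6) k ⟩
      N′ * K                    ∎

  k<c₀x^s⇒6k<x^s : ∀ {k x} a b q → pow k (suc q) * pow x a < pow c₀ (suc q) * pow x b →
                        (ℕ→ℚ 6 * k) ^ suc q * x ^ a < x ^ b
  k<c₀x^s⇒6k<x^s {k} {x} a b q k<c₀x^s = begin-strict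
    (6′ * k) ^ Q * x ^ a        ≡⟨ cong (_* x ^ a) (^-distrib-* 6′ k Q) ⟩
    6′ ^ Q * k ^ Q * x ^ a      ≡⟨ ℚP.*-assoc (6′ ^ Q) (k ^ Q) (x ^ a) ⟩
    6′ ^ Q * (k ^ Q * x ^ a)    <⟨ ℚP.*-monoʳ-<-pos (6′ ^ Q) {{ℚ.positive (^-pos Q (ℕ→ℚ-pos 6))}}
                                     (subst₂ _<_ (cong₂ _*_ (pow≡^ k Q) (pow≡^ x a))
                                                 (cong₂ _*_ (pow≡^ c₀ Q) (pow≡^ x b)) k<c₀x^s) ⟩
    6′ ^ Q * (c₀ ^ Q * x ^ b)   ≡⟨ ℚP.*-assoc (6′ ^ Q) (c₀ ^ Q) (x ^ b) ⟨
    6′ ^ Q * c₀ ^ Q * x ^ b     ≡⟨ cong (_* x ^ b) (^-distrib-* 6′ c₀ Q) ⟨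
    (6′ * c₀) ^ Q * x ^ b       ≡⟨ cong (_* x ^ b) (^-zeroˡ Q) ⟩
    1ℚ * x ^ b                  ≡⟨ ℚP.*-identityˡ (x ^ b) ⟩
    x ^ b                       ∎
    where
    open ℚP.≤-Reasoning
    6′ = ℕ→ℚ 6
    Q = suc q

open import Data.Nat using (ℕ; suc; _∸_; _*_)
open import Data.Nat as ℕ using ()
open import Data.Rational using (ℚ; 0ℚ; _<_; _≤_; _+_)
open import Data.Rational as ℚ using ()
open import Data.Product using (_×_; ∃-syntax; _,_)
import Data.Nat.Properties as ℕP
import Data.Rational.Properties as ℚP
open ℕ→ℚ-Properties using (ℕ→ℚ-pos; ℕ→ℚ-nonNeg; ℕ→ℚ-mono-≤)
open RationalOrder using (*-nonNeg)
open RationalPower using (^-bounds⇒exponent-<)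
open Golden using (largest-≤γ₀*; module Exponents)
open ExponentBound using (exponent-bound)
open DivisorsNear2N using (c₀; many-divisors⇒power-bound; k<c₀x^s⇒6k<x^s)

few-divisors-near-2N : ∀ (r : ℕ) → 3 ℕ.≤ r → ∀ (N : ℕ) → 1 ℕ.≤ N → ∀ (k : ℚ) → 0ℚ < k →
                       BelowBound c₀ (ℕ→ℚ 2) r N k →
                       ∀ (m : ℕ) → 1 ℕ.≤ m → ℕ→ℚ m ≤ ℕ→ℚ (3 * N) ℚ.* k →
                       τ m (ℕ→ℚ (2 * N)) (ℕ→ℚ (2 * N) + ℕ→ℚ 2 ℚ.* k) ℕ.≤ r ∸ 1
few-divisors-near-2N r@(suc r-1) (ℕ.s≤s 2≤r-1) N 1≤N k 0<k (a , b , q , t<γ₀ , k<c₀N^s) m 1≤m m≤3Nk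
  with largest-≤γ₀* r (ℕP.m≤n⇒m≤1+n 2≤r-1)
... | β , α≤γ₀*r , α+1≰γ₀*r =
  ℕP.≤-pred (ℕP.≰⇒> λ r≤τ → ℕP.<-asym
    (exponent-bound r β α≤γ₀*r α+1≰γ₀*r a b q t<γ₀)
    (^-bounds⇒exponent-< (r * α) A a b (suc q) Y (ℕ→ℚ-mono-≤ 1≤N) (*-nonNeg (ℕ→ℚ-nonNeg 6) (ℚP.<⇒≤ 0<k))
      (many-divisors⇒power-bound α {r} {N} {m} {k} {{ℕ.>-nonZero 1≤m}} 0<k m≤3Nk r≤τ)
      (k<c₀x^s⇒6k<x^s {k} {ℕ→ℚ N} a b q k<c₀N^s)))
  where open Exponents r β

theorem3p1 : ∃[ c₀ ] ∃[ C ] (0ℚ < c₀ × 0ℚ < C ×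
    ( ∀ (r : ℕ) → 3 ℕ.≤ r → ∀ (N : ℕ) → 1 ℕ.≤ N → ∀ (k : ℚ) → 0ℚ < k →
    BelowBound c₀ C r N k →
    ∀ (m : ℕ) → 1 ℕ.≤ m → ℕ→ℚ m ≤ ℕ→ℚ (3 * N) ℚ.* k →
    τ m (ℕ→ℚ (2 * N)) (ℕ→ℚ (2 * N) + ℕ→ℚ 2 ℚ.* k) ℕ.≤ r ∸ 1 ))
theorem3p1 = c₀ , ℕ→ℚ 2 , ℚP.positive⁻¹ c₀ , ℕ→ℚ-pos 2 , few-divisors-near-2N
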